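{- Let $q$ be a prime power, $t\ge2$, $k\ge2$, and let $P$ be a point of $\mathrm{PG}(1,q^t)$. Let $\pi,\pi'$ be $(k-1)$-dimensional subspaces of $\mathrm{PG}(2t-1,q)$ such that $L_\pi=L_{\pi'}$ is a club of rank $k$ with head $P$ with respect to both, i.e. $\pi\cap\mathcal{F}(P)$ and $\pi'\cap\mathcal{F}(P)$ are $(k-2)$-dimensional. If there is a point $r\in\pi\cap\pi'$ with $r\notin\mathcal{F}(P)$, then $\pi=\pi'$. Hence there are $\frac{q^t-1}{q-1}$ subspaces $\pi'$ such that $L_\pi=L_{\pi'}$ is a club with head $P$.
   Context: Field reduction: viewing $\mathbb{F}_{q^t}^2$ as $\mathbb{F}_q^{2t}$, each point $X$ of $\mathrm{PG}(1,q^t)$ corresponds to a $(t-1)$-space $\mathcal{F}(X)$ of $\mathrm{PG}(2t-1,q)$; these form the Desarguesian $(t-1)$-spread $\mathcal{D}$. For a subspace $\pi$, $\mathcal{B}(\pi)$ is the set of elements of $\mathcal{D}$ meeting $\pi$, and $L_\pi$ is the point set of $\mathrm{PG}(1,q^t)$ with $\mathcal{F}(L_\pi)=\mathcal{B}(\pi)$ (an $\mathbb{F}_q$-linear set of rank $\dim\pi+1$). The weight of $X\in L_\pi$ is $\dim(\mathcal{F}(X)\cap\pi)+1$. A club of rank $k$ is $L_\pi$, $\pi$ a $(k-1)$-space, with one point (the head) of weight $k-1$ and all others of weight $1$. -}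

module Defs where

open import Level using (Level; _⊔_)
open import Algebra.Bundles using (CommutativeRing)
open import Data.Nat as ℕ using (ℕ; zero; suc; _^_)
open import Data.Nat.Primality using (Prime)
open import Data.Fin using (Fin)
open import Data.Product using (Σ; ∃; ∃₂; _×_; _,_)
open import Relation.Binary.PropositionalEquality using (_≡_)
open import Relation.Nullary using (¬_)

IsPrimePower : ℕ → Set
IsPrimePower q = ∃₂ λ p m → Prime p × q ≡ p ^ suc m

module _ {c ℓ : Level} (K : CommutativeRing c ℓ) where
  open CommutativeRing K

  IsField : Set (c ⊔ ℓ)
  IsField = (¬ (1# ≈ 0#)) × (∀ x → ¬ (x ≈ 0#) → ∃ λ y → x * y ≈ 1#)

  HasSize : ℕ → Set (c ⊔ ℓ)
  HasSize n = Σ (Fin n → Carrier) λ e →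
    (∀ i j → e i ≈ e j → i ≡ j) × (∀ x → ∃ λ i → e i ≈ x)

  IsSubfield : (Carrier → Set ℓ) → Set (c ⊔ ℓ)
  IsSubfield F =
    (∀ x y → x ≈ y → F x → F y) × F 0# × F 1#
    × (∀ x y → F x → F y → F (x + y)) × (∀ x → F x → F (- x))
    × (∀ x y → F x → F y → F (x * y))
    × (∀ x y → F x → x * y ≈ 1# → F y)

  SubHasSize : (Carrier → Set ℓ) → ℕ → Set (c ⊔ ℓ)
  SubHasSize F n = Σ (Fin n → Carrier) λ e →
    (∀ i → F (e i)) × (∀ i j → e i ≈ e j → i ≡ j)
    × (∀ x → F x → ∃ λ i → e i ≈ x)

  -- the vector space K² (= F_{q^t}^2, viewed as F_q^{2t})
  V : Set c
  V = Carrier × Carrier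

  _≈v_ : V → V → Set ℓ
  (a , b) ≈v (a' , b') = (a ≈ a') × (b ≈ b')

  0v : V
  0v = 0# , 0#

  _+v_ : V → V → V
  (a , b) +v (a' , b') = (a + a') , (b + b')

  _·_ : Carrier → V → V
  λ' · (a , b) = (λ' * a) , (λ' * b)

  NonZeroV : V → Set ℓ
  NonZeroV v = ¬ (v ≈v 0v)

  lc : ∀ {n} → (Fin n → Carrier) → (Fin n → V) → V
  lc {zero}  cs b = 0v
  lc {suc n} cs b = (cs Fin.zero · b Fin.zero) +v lc (λ i → cs (Fin.suc i)) (λ i → b (Fin.suc i))
    where import Data.Fin as Fin

  module _ (F : Carrier → Set ℓ) where

    InFSpan : ∀ {n} → (Fin n → V) → V → Set (c ⊔ ℓ)
    InFSpan b v = ∃ λ cs → (∀ i → F (cs i)) × (v ≈v lc cs b)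

    FIndep : ∀ {n} → (Fin n → V) → Set (c ⊔ ℓ)
    FIndep b = ∀ cs → (∀ i → F (cs i)) → lc cs b ≈v 0v → ∀ i → cs i ≈ 0#

    SameSpan : ∀ {n m} → (Fin n → V) → (Fin m → V) → Set (c ⊔ ℓ)
    SameSpan b b' = (∀ v → InFSpan b v → InFSpan b' v) × (∀ v → InFSpan b' v → InFSpan b v)

    IsFDim : ∀ {a} → (V → Set a) → ℕ → Set (c ⊔ ℓ ⊔ a)
    IsFDim W d = Σ (Fin d → V) λ b → (∀ i → W (b i)) × FIndep b × (∀ v → W v → InFSpan b v)

    -- 𝓕(X) for the point X = ⟨x⟩_K of PG(1,q^t): the K-span of x
    InKSpan : V → V → Set (c ⊔ ℓ)
    InKSpan x v = ∃ λ μ → v ≈v (μ · x)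

    Meet : ∀ {n} → V → (Fin n → V) → V → Set (c ⊔ ℓ)
    Meet x b v = InKSpan x v × InFSpan b v

    -- X = ⟨x⟩_K ∈ L_π, π = ⟨b⟩_F : 𝓕(X) meets π in a (projective) point
    InL : ∀ {n} → (Fin n → V) → V → Set (c ⊔ ℓ)
    InL b x = ∃ λ v → NonZeroV v × Meet x b v

    SameL : ∀ {n m} → (Fin n → V) → (Fin m → V) → Set (c ⊔ ℓ)
    SameL b b' = ∀ x → NonZeroV x → (InL b x → InL b' x) × (InL b' x → InL b x)

    -- π = ⟨b⟩_F is a (k-1)-space: b is an F-basis of k vectors
    -- L_π is a club of rank k with head P = ⟨p⟩_K (w.r.t. π):
    --   weight of P is k-1  (dim_F (𝓕(P) ∩ π) = k-1, projective dim k-2)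
    --   every other point X of L_π has weight 1
    IsClub : ∀ (k : ℕ) → (Fin k → V) → V → Set (c ⊔ ℓ)
    IsClub k b p =
      IsFDim (Meet p b) (k ℕ.∸ 1)
      × (∀ x → NonZeroV x → ¬ InKSpan p x → InL b x → IsFDim (Meet x b) 1)

module Submission where

-- Write π = ⟨b⟩_F and 𝓕(P) = ⟨p⟩_K.  Since π ∩ 𝓕(P) is a hyperplane of π, any r ∈ π ∖ 𝓕(P) gives
-- π = (π ∩ 𝓕(P)) ⊕ ⟨r⟩_F.  If also r ∈ π', then for u ∈ π ∩ 𝓕(P) the point ⟨u + r⟩ lies in L_π = L_π',
-- so μ(u + r) ∈ π' for some μ; decomposing μ(u + r) in π' the same way forces μ ∈ F, hence u + r ∈ π',
-- and π ⊆ π' follows (and symmetrically).  For the count: if π' is another such club then μr ∈ π' for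
-- some μ ∈ K*, and μ⁻¹π' contains r, so μ⁻¹π' = π by the first part.  Conversely μπ = νπ forces
-- μ/ν ∈ F because ⟨r⟩ has weight one.  So these clubs correspond to the cosets of F* in K*, of which
-- there are (q^t - 1)/(q - 1).

open import Defs
open import Algebra.Bundles using (CommutativeRing)
open import Data.Nat using (ℕ; _^_; _∸_; _≤_; NonZero)
open import Data.Nat.DivMod using (_/_)
open import Data.Fin using (Fin)
open import Data.Product using (Σ; ∃; _×_)
open import Relation.Binary.PropositionalEquality using (_≡_)
open import Relation.Nullary using (¬_)

open import Level using (_⊔_)
open import Data.Empty using (⊥-elim)
open import Data.Fin as Fin using (zero; suc; punchIn; punchOut; combine; remQuot)
open import Data.Fin.Properties
  using (punchInᵢ≢i; punchIn-injective; punchIn-punchOut; suc-injective; any?; all?; ¬∀⟶∃¬; _≤?_; ≤-antisym;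
         combine-injective; combine-remQuot; cantor-schröder-bernstein)
open import Data.Nat as ℕ using (zero; suc; s≤s; z≤n)
open import Data.Nat.DivMod using (m*n/n≡m)
open import Data.Product using (_,_; proj₁; proj₂; uncurry)
open import Data.Product.Relation.Binary.Pointwise.NonDependent using (×-setoid)
open import Data.Unit using (⊤; tt)
open import Data.Vec.Functional using (insertAt)
open import Data.Vec.Functional.Properties using (insertAt-punchIn)
open import Relation.Binary.Bundles using (Setoid)
import Relation.Binary.Definitions as B
import Relation.Binary.PropositionalEquality as ≡
open import Relation.Binary.PropositionalEquality using (_≢_; cong)
import Relation.Binary.Reasoning.Setoid as SetoidReasoning
open import Relation.Nullary using (Dec; yes; no; ¬?)
open import Relation.Nullary.Decidable using (map′; decidable-stable; _×-dec_; _→-dec_)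
open import Relation.Unary using (Pred; Decidable)

module _ {c ℓ} (S : Setoid c ℓ) where
  open Setoid S

  record Enumeration {a} (P : Pred Carrier a) (n : ℕ) : Set (c ⊔ ℓ ⊔ a) where
    field
      element : Fin n → Carrier
      element∈P : ∀ i → P (element i)
      element-injective : ∀ {i j} → element i ≈ element j → i ≡ j
      element-surjective : ∀ {x} → P x → ∃ λ i → element i ≈ x

    index : ∀ {x} → P x → Fin n
    index Px = proj₁ (element-surjective Px)

    element-index : ∀ {x} (Px : P x) → element (index Px) ≈ x
    element-index Px = proj₂ (element-surjective Px)

    index-injective : ∀ {x y} (Px : P x) (Py : P y) → index Px ≡ index Py → x ≈ y
    index-injective Px Py e = trans (sym (element-index Px)) (trans (reflexive (cong element e)) (element-index Py))

  module _ {a} {P : Pred Carrier a} where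

    Enumeration-empty : Enumeration P 0 → ∀ {x} → ¬ P x
    Enumeration-empty E Px with Enumeration.index E Px
    ... | ()

    Enumeration⇒≈-dec : ∀ {n} → Enumeration P n → ∀ {x y} → P x → P y → Dec (x ≈ y)
    Enumeration⇒≈-dec E Px Py =
      map′ (index-injective Px Py)
           (λ x≈y → element-injective (trans (element-index Px) (trans x≈y (sym (element-index Py)))))
           (index Px Fin.≟ index Py)
      where open Enumeration E

    Enumeration-remove : ∀ {n z} → Enumeration P (suc n) → P z → Enumeration (λ x → P x × ¬ x ≈ z) n
    Enumeration-remove {n} {z} E Pz = record
      { element = λ j → element (punchIn i₀ j)
      ; element∈P = λ j → element∈P _ , λ e → punchInᵢ≢i i₀ j (element-injective (trans e (sym (element-index Pz))))
      ; element-injective = λ e → punchIn-injective i₀ _ _ (element-injective e)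
      ; element-surjective = λ { (Px , x≉z) → surjective Px x≉z }
      }
      where
      open Enumeration E
      i₀ : Fin (suc n)
      i₀ = index Pz
      surjective : ∀ {x} (Px : P x) → ¬ x ≈ z → ∃ λ j → element (punchIn i₀ j) ≈ x
      surjective Px x≉z = punchOut i₀≢i , trans (reflexive (cong element (punchIn-punchOut i₀≢i))) (element-index Px)
        where
        i₀≢i : i₀ ≢ index Px
        i₀≢i i₀≡i = x≉z (index-injective Px Pz (≡.sym i₀≡i))

module _ {a} {n : ℕ} {P : Pred (Fin (suc n)) a} where

  Enumeration-cons : ∀ {m} → P zero → Enumeration (≡.setoid (Fin n)) (λ i → P (suc i)) m →
                     Enumeration (≡.setoid (Fin (suc n))) P (suc m)
  Enumeration-cons P0 E = record
    { element = λ { zero → zero ; (suc i) → suc (element i) }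
    ; element∈P = λ { zero → P0 ; (suc i) → element∈P i }
    ; element-injective = λ { {zero} {zero} _ → ≡.refl
                            ; {suc i} {suc j} e → cong suc (element-injective (suc-injective e)) }
    ; element-surjective = λ { {zero} _ → zero , ≡.refl
                             ; {suc x} Px → suc (index Px) , cong suc (element-index Px) }
    }
    where open Enumeration E

  Enumeration-skip : ∀ {m} → ¬ P zero → Enumeration (≡.setoid (Fin n)) (λ i → P (suc i)) m →
                     Enumeration (≡.setoid (Fin (suc n))) P m
  Enumeration-skip ¬P0 E = record
    { element = λ i → suc (element i)
    ; element∈P = element∈P
    ; element-injective = λ e → element-injective (suc-injective e)
    ; element-surjective = λ { {zero} P0 → ⊥-elim (¬P0 P0)
                             ; {suc x} Px → index Px , cong suc (element-index Px) }
    }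
    where open Enumeration E

enumerate : ∀ {a} n {P : Pred (Fin n) a} → Decidable P → ∃ λ m → Enumeration (≡.setoid (Fin n)) P m
enumerate zero P? = 0 , record
  { element = λ () ; element∈P = λ () ; element-injective = λ { {()} } ; element-surjective = λ { {()} } }
enumerate (suc n) P? with P? zero | enumerate n (λ i → P? (suc i))
... | yes P0 | m , E = suc m , Enumeration-cons P0 E
... | no ¬P0 | m , E = m , Enumeration-skip ¬P0 E

least : ∀ {a} {n} {P : Pred (Fin n) a} → Decidable P → ∀ {j} → P j →
        Σ (Fin n) λ i → P i × (∀ {j} → P j → i Fin.≤ j)
least {n = suc n} P? {j} Pj with P? zero
... | yes P0 = zero , P0 , λ _ → ℕ.z≤n
least {n = suc n} P? {zero} P0 | no ¬P0 = ⊥-elim (¬P0 P0)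
least {n = suc n} P? {suc j} Pj | no ¬P0 with least (λ i → P? (suc i)) Pj
... | i , Pi , i-least = suc i , Pi , λ { {zero} P0 → ⊥-elim (¬P0 P0) ; {suc j} Pj → ℕ.s≤s (i-least Pj) }

remQuot-injective : ∀ n {k} {x y : Fin (n ℕ.* k)} → remQuot {n} k x ≡ remQuot k y → x ≡ y
remQuot-injective n {k} {x} {y} e =
  ≡.trans (≡.sym (combine-remQuot {n} k x)) (≡.trans (cong (uncurry combine) e) (combine-remQuot {n} k y))

combine-injective′ : ∀ {n k} {x y : Fin n × Fin k} → uncurry combine x ≡ uncurry combine y → x ≡ y
combine-injective′ {x = i , s} {j , t} e = uncurry (≡.cong₂ _,_) (combine-injective i s j t e)

module _ {c ℓ} (K : CommutativeRing c ℓ) where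
  open CommutativeRing K

  HasSize⇒Enumeration : ∀ {n} → HasSize K n → Enumeration setoid (λ _ → ⊤) n
  HasSize⇒Enumeration (e , injective , surjective) = record
    { element = e
    ; element∈P = λ _ → tt
    ; element-injective = injective _ _
    ; element-surjective = λ {x} _ → surjective x
    }

  SubHasSize⇒Enumeration : ∀ {F n} → SubHasSize K F n → Enumeration setoid F n
  SubHasSize⇒Enumeration (e , e∈F , injective , surjective) = record
    { element = e
    ; element∈P = e∈F
    ; element-injective = injective _ _
    ; element-surjective = surjective _
    }

  HasSize⇒≈-dec : ∀ {n} → HasSize K n → ∀ x y → Dec (x ≈ y)
  HasSize⇒≈-dec HK x y = Enumeration⇒≈-dec setoid (HasSize⇒Enumeration HK) tt tt

module FieldExtension {c ℓ} (K : CommutativeRing c ℓ) (F : CommutativeRing.Carrier K → Set ℓ)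
  (isField : IsField K) (isSubfield : IsSubfield K F)
  (_≟_ : B.Decidable (CommutativeRing._≈_ K)) where

  open CommutativeRing K hiding (zero)
  open import Algebra.Properties.Ring ring
    using (-‿distribˡ-*; -‿distribʳ-*; -1*x≈-x; +-inverseˡ-unique; x∙y⁻¹≈ε⇒x≈y)
  open import Algebra.Properties.CommutativeSemigroup +-commutativeSemigroup using () renaming (interchange to +-interchange)
  open import Algebra.Properties.Monoid.Sum +-monoid using (sum)
  module ≈-Reasoning = SetoidReasoning setoid

  1≉0 : 1# ≉ 0#
  1≉0 = proj₁ isField

  inverse : ∀ x → x ≉ 0# → Carrier
  inverse x x≉0 = proj₁ (proj₂ isField x x≉0)

  *-inverseʳ : ∀ x (x≉0 : x ≉ 0#) → x * inverse x x≉0 ≈ 1#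
  *-inverseʳ x x≉0 = proj₂ (proj₂ isField x x≉0)

  *-inverseˡ : ∀ x (x≉0 : x ≉ 0#) → inverse x x≉0 * x ≈ 1#
  *-inverseˡ x x≉0 = trans (*-comm _ _) (*-inverseʳ x x≉0)

  *-≉0 : ∀ {x y} → x ≉ 0# → y ≉ 0# → x * y ≉ 0#
  *-≉0 {x} {y} x≉0 y≉0 xy≈0 = y≉0 (begin
    y                        ≈⟨ sym (*-identityˡ y) ⟩
    1# * y                   ≈⟨ *-congʳ (sym (*-inverseˡ x x≉0)) ⟩
    (inverse x x≉0 * x) * y  ≈⟨ *-assoc _ _ _ ⟩
    inverse x x≉0 * (x * y)  ≈⟨ *-congˡ xy≈0 ⟩
    inverse x x≉0 * 0#       ≈⟨ zeroʳ _ ⟩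
    0#                       ∎)
    where open ≈-Reasoning

  ≈-*-unscale : ∀ {a κ x y} → κ * a ≈ 1# → y ≈ a * x → x ≈ κ * y
  ≈-*-unscale {a} {κ} {x} {y} κa≈1 y≈ax = begin
    x            ≈⟨ sym (*-identityˡ x) ⟩
    1# * x       ≈⟨ *-congʳ (sym κa≈1) ⟩
    (κ * a) * x  ≈⟨ *-assoc _ _ _ ⟩
    κ * (a * x)  ≈⟨ *-congˡ (sym y≈ax) ⟩
    κ * y        ∎
    where open ≈-Reasoning

  *-cancelʳ-≉0 : ∀ {a b x} → x ≉ 0# → a * x ≈ b * x → a ≈ b
  *-cancelʳ-≉0 {a} {b} {x} x≉0 ax≈bx = begin
    a                        ≈⟨ ≈-*-unscale (*-inverseˡ x x≉0) (*-comm a x) ⟩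
    inverse x x≉0 * (a * x)  ≈⟨ *-congˡ ax≈bx ⟩
    inverse x x≉0 * (b * x)  ≈⟨ sym (≈-*-unscale (*-inverseˡ x x≉0) (*-comm b x)) ⟩
    b                        ∎
    where open ≈-Reasoning

  F-resp : ∀ {x y} → x ≈ y → F x → F y
  F-resp {x} {y} = proj₁ isSubfield x y

  F-0# : F 0#
  F-0# = proj₁ (proj₂ isSubfield)

  F-1# : F 1#
  F-1# = proj₁ (proj₂ (proj₂ isSubfield))

  F-+ : ∀ {x y} → F x → F y → F (x + y)
  F-+ {x} {y} = proj₁ (proj₂ (proj₂ (proj₂ isSubfield))) x y

  F-neg : ∀ {x} → F x → F (- x)
  F-neg {x} = proj₁ (proj₂ (proj₂ (proj₂ (proj₂ isSubfield)))) x

  F-* : ∀ {x y} → F x → F y → F (x * y)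
  F-* {x} {y} = proj₁ (proj₂ (proj₂ (proj₂ (proj₂ (proj₂ isSubfield))))) x y

  F-inverse-of : ∀ {x y} → F x → x * y ≈ 1# → F y
  F-inverse-of {x} {y} Fx xy≈1 = proj₂ (proj₂ (proj₂ (proj₂ (proj₂ (proj₂ isSubfield))))) x y Fx xy≈1

  F-inverse : ∀ {x} (x≉0 : x ≉ 0#) → F x → F (inverse x x≉0)
  F-inverse {x} x≉0 Fx = F-inverse-of Fx (*-inverseʳ x x≉0)

  F-sum : ∀ {n} (f : Fin n → Carrier) → (∀ i → F (f i)) → F (sum f)
  F-sum {zero} f Ff = F-0#
  F-sum {suc n} f Ff = F-+ (Ff zero) (F-sum (λ i → f (suc i)) (λ i → Ff (suc i)))

  infix 4 _≋_
  infixl 6 _⊕_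
  infixr 7 _•_

  _≋_ : V K → V K → Set ℓ
  _≋_ = _≈v_ K

  _⊕_ : V K → V K → V K
  _⊕_ = _+v_ K

  _•_ : Carrier → V K → V K
  _•_ = _·_ K

  𝟎 : V K
  𝟎 = 0v K

  V-setoid : Setoid c ℓ
  V-setoid = ×-setoid setoid setoid

  module ≋ = Setoid V-setoid
  module ≋-Reasoning = SetoidReasoning V-setoid

  ⊕-cong : ∀ {u u' v v'} → u ≋ u' → v ≋ v' → u ⊕ v ≋ u' ⊕ v'
  ⊕-cong (e₁ , e₂) (f₁ , f₂) = +-cong e₁ f₁ , +-cong e₂ f₂

  •-cong : ∀ {a a' u u'} → a ≈ a' → u ≋ u' → a • u ≋ a' • u'
  •-cong e (f₁ , f₂) = *-cong e f₁ , *-cong e f₂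

  •-congˡ : ∀ {a u u'} → u ≋ u' → a • u ≋ a • u'
  •-congˡ = •-cong refl

  •-congʳ : ∀ {a a' u} → a ≈ a' → a • u ≋ a' • u
  •-congʳ e = •-cong e ≋.refl

  ⊕-comm : ∀ u v → u ⊕ v ≋ v ⊕ u
  ⊕-comm _ _ = +-comm _ _ , +-comm _ _

  ⊕-assoc : ∀ u v w → (u ⊕ v) ⊕ w ≋ u ⊕ (v ⊕ w)
  ⊕-assoc _ _ _ = +-assoc _ _ _ , +-assoc _ _ _

  ⊕-identityˡ : ∀ u → 𝟎 ⊕ u ≋ u
  ⊕-identityˡ _ = +-identityˡ _ , +-identityˡ _

  ⊕-identityʳ : ∀ u → u ⊕ 𝟎 ≋ u
  ⊕-identityʳ _ = +-identityʳ _ , +-identityʳ _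

  •-distribˡ : ∀ a u v → a • (u ⊕ v) ≋ a • u ⊕ a • v
  •-distribˡ _ _ _ = distribˡ _ _ _ , distribˡ _ _ _

  •-distribʳ : ∀ a b u → (a + b) • u ≋ a • u ⊕ b • u
  •-distribʳ _ _ _ = distribʳ _ _ _ , distribʳ _ _ _

  •-assoc : ∀ a b u → a • (b • u) ≋ (a * b) • u
  •-assoc _ _ _ = sym (*-assoc _ _ _) , sym (*-assoc _ _ _)

  •-identityˡ : ∀ u → 1# • u ≋ u
  •-identityˡ _ = *-identityˡ _ , *-identityˡ _

  •-zeroˡ : ∀ u → 0# • u ≋ 𝟎
  •-zeroˡ _ = zeroˡ _ , zeroˡ _

  •-zeroʳ : ∀ a → a • 𝟎 ≋ 𝟎
  •-zeroʳ _ = zeroʳ _ , zeroʳ _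

  ⊕-swap : ∀ u v w → u ⊕ (v ⊕ w) ≋ v ⊕ (u ⊕ w)
  ⊕-swap u v w = ≋.trans (≋.sym (⊕-assoc u v w)) (≋.trans (⊕-cong (⊕-comm u v) ≋.refl) (⊕-assoc v u w))

  ⊕-interchange : ∀ u v w x → (u ⊕ v) ⊕ (w ⊕ x) ≋ (u ⊕ w) ⊕ (v ⊕ x)
  ⊕-interchange u v w x = ≋.trans (⊕-assoc u v (w ⊕ x))
    (≋.trans (⊕-cong ≋.refl (⊕-swap v w x)) (≋.sym (⊕-assoc u w (v ⊕ x))))

  ⊕-•-cancelʳ : ∀ u a v → (u ⊕ a • v) ⊕ (- a) • v ≋ u
  ⊕-•-cancelʳ u a v = begin
    (u ⊕ a • v) ⊕ (- a) • v  ≈⟨ ⊕-assoc _ _ _ ⟩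
    u ⊕ (a • v ⊕ (- a) • v)  ≈⟨ ⊕-cong ≋.refl (≋.sym (•-distribʳ a (- a) v)) ⟩
    u ⊕ (a + - a) • v        ≈⟨ ⊕-cong ≋.refl (•-congʳ (-‿inverseʳ a)) ⟩
    u ⊕ 0# • v               ≈⟨ ⊕-cong ≋.refl (•-zeroˡ v) ⟩
    u ⊕ 𝟎                    ≈⟨ ⊕-identityʳ u ⟩
    u                        ∎
    where open ≋-Reasoning

  •-unscale : ∀ {a κ u w} → κ * a ≈ 1# → a • u ≋ w → u ≋ κ • w
  •-unscale {a} {κ} {u} {w} κa≈1 au≋w = begin
    u              ≈⟨ ≋.sym (•-identityˡ u) ⟩
    1# • u         ≈⟨ •-congʳ (sym κa≈1) ⟩
    (κ * a) • u    ≈⟨ ≋.sym (•-assoc κ a u) ⟩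
    κ • (a • u)    ≈⟨ •-congˡ au≋w ⟩
    κ • w          ∎
    where open ≋-Reasoning

  •-≉𝟎 : ∀ {a κ u} → κ * a ≈ 1# → NonZeroV K u → NonZeroV K (a • u)
  •-≉𝟎 {κ = κ} κa≈1 u≉0 au≈0 = u≉0 (≋.trans (•-unscale κa≈1 au≈0) (•-zeroʳ κ))

  scalar-≉0 : ∀ {a u v} → v ≋ a • u → NonZeroV K v → a ≉ 0#
  scalar-≉0 {a} {u} v≋au v≉0 a≈0 = v≉0 (≋.trans v≋au (≋.trans (•-congʳ a≈0) (•-zeroˡ u)))

  •-zero-divisor : ∀ {a u} → NonZeroV K u → a • u ≋ 𝟎 → a ≈ 0#
  •-zero-divisor {a} u≉0 au≈0 with a ≟ 0#
  ... | yes a≈0 = a≈0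
  ... | no a≉0 = ⊥-elim (•-≉𝟎 (*-inverseˡ a a≉0) u≉0 au≈0)

  lc-+ : ∀ {n} (cs ds : Fin n → Carrier) (b : Fin n → V K) →
         lc K (λ i → cs i + ds i) b ≋ lc K cs b ⊕ lc K ds b
  lc-+ {zero} _ _ _ = ≋.sym (⊕-identityˡ 𝟎)
  lc-+ {suc n} cs ds b = ≋.trans
    (⊕-cong (•-distribʳ (cs zero) (ds zero) (b zero)) (lc-+ (λ i → cs (suc i)) (λ i → ds (suc i)) (λ i → b (suc i))))
    (⊕-interchange _ _ _ _)

  lc-* : ∀ {n} a (cs : Fin n → Carrier) (b : Fin n → V K) → lc K (λ i → a * cs i) b ≋ a • lc K cs b
  lc-* {zero} a _ _ = ≋.sym (•-zeroʳ a)
  lc-* {suc n} a cs b = ≋.trans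
    (⊕-cong (≋.sym (•-assoc a (cs zero) (b zero))) (lc-* a (λ i → cs (suc i)) (λ i → b (suc i))))
    (≋.sym (•-distribˡ a _ _))

  lc-• : ∀ {n} a (cs : Fin n → Carrier) (b : Fin n → V K) → lc K cs (λ i → a • b i) ≋ a • lc K cs b
  lc-• {zero} a _ _ = ≋.sym (•-zeroʳ a)
  lc-• {suc n} a cs b = ≋.trans
    (⊕-cong (≋.trans (•-assoc (cs zero) a (b zero))
              (≋.trans (•-congʳ (*-comm _ _)) (≋.sym (•-assoc a (cs zero) (b zero)))))
            (lc-• a (λ i → cs (suc i)) (λ i → b (suc i))))
    (≋.sym (•-distribˡ a _ _))

  lc-⊕ : ∀ {n} (cs : Fin n → Carrier) (u w : Fin n → V K) → lc K cs (λ i → u i ⊕ w i) ≋ lc K cs u ⊕ lc K cs w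
  lc-⊕ {zero} _ _ _ = ≋.sym (⊕-identityˡ 𝟎)
  lc-⊕ {suc n} cs u w = ≋.trans
    (⊕-cong (•-distribˡ (cs zero) (u zero) (w zero)) (lc-⊕ (λ i → cs (suc i)) (λ i → u (suc i)) (λ i → w (suc i))))
    (⊕-interchange _ _ _ _)

  lc-multiples : ∀ {n} (cs as : Fin n → Carrier) x → lc K cs (λ i → as i • x) ≋ sum (λ i → cs i * as i) • x
  lc-multiples {zero} _ _ x = ≋.sym (•-zeroˡ x)
  lc-multiples {suc n} cs as x = ≋.trans
    (⊕-cong (•-assoc (cs zero) (as zero) x) (lc-multiples (λ i → cs (suc i)) (λ i → as (suc i)) x))
    (≋.sym (•-distribʳ _ _ x))

  lc-zeroˡ : ∀ {n} {cs : Fin n → Carrier} (b : Fin n → V K) → (∀ i → cs i ≈ 0#) → lc K cs b ≋ 𝟎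
  lc-zeroˡ {zero} _ _ = ≋.refl
  lc-zeroˡ {suc n} b cs≈0 = ≋.trans
    (⊕-cong (≋.trans (•-congʳ (cs≈0 zero)) (•-zeroˡ _)) (lc-zeroˡ (λ i → b (suc i)) (λ i → cs≈0 (suc i))))
    (⊕-identityˡ 𝟎)

  lc-zeroʳ : ∀ {n} (cs : Fin n → Carrier) {b : Fin n → V K} → (∀ i → b i ≋ 𝟎) → lc K cs b ≋ 𝟎
  lc-zeroʳ {zero} _ _ = ≋.refl
  lc-zeroʳ {suc n} cs b≈0 = ≋.trans
    (⊕-cong (≋.trans (•-congˡ (b≈0 zero)) (•-zeroʳ _)) (lc-zeroʳ (λ i → cs (suc i)) (λ i → b≈0 (suc i))))
    (⊕-identityˡ 𝟎)

  lc-insertAt : ∀ {n} (cs : Fin n → Carrier) j a (w : Fin (suc n) → V K) →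
                lc K (insertAt cs j a) w ≋ a • w j ⊕ lc K cs (λ i → w (punchIn j i))
  lc-insertAt cs zero a w = ≋.refl
  lc-insertAt {suc n} cs (suc j) a w =
    ≋.trans (⊕-cong ≋.refl (lc-insertAt (λ i → cs (suc i)) j a (λ i → w (suc i)))) (⊕-swap _ _ _)

  insertAt-all : ∀ {a} {n} (P : Carrier → Set a) (cs : Fin n → Carrier) j {x} →
                 (∀ i → P (cs i)) → P x → ∀ i → P (insertAt cs j x i)
  insertAt-all P cs zero Pcs Px zero = Px
  insertAt-all P cs zero Pcs Px (suc i) = Pcs i
  insertAt-all {n = suc n} P cs (suc j) Pcs Px zero = Pcs zero
  insertAt-all {n = suc n} P cs (suc j) Pcs Px (suc i) = insertAt-all P (λ i → cs (suc i)) j (λ i → Pcs (suc i)) Px i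

  infix 4 _∈F⟨_⟩ _∈K⟨_⟩

  _∈F⟨_⟩ : ∀ {n} → V K → (Fin n → V K) → Set (c ⊔ ℓ)
  v ∈F⟨ b ⟩ = InFSpan K F b v

  _∈K⟨_⟩ : V K → V K → Set (c ⊔ ℓ)
  v ∈K⟨ x ⟩ = InKSpan K F x v

  module Span {n} (b : Fin n → V K) where

    resp : ∀ {u v} → u ≋ v → u ∈F⟨ b ⟩ → v ∈F⟨ b ⟩
    resp u≋v (cs , Fcs , u≋) = cs , Fcs , ≋.trans (≋.sym u≋v) u≋

    𝟎∈ : 𝟎 ∈F⟨ b ⟩
    𝟎∈ = (λ _ → 0#) , (λ _ → F-0#) , ≋.sym (lc-zeroˡ b (λ _ → refl))

    ⊕∈ : ∀ {u v} → u ∈F⟨ b ⟩ → v ∈F⟨ b ⟩ → u ⊕ v ∈F⟨ b ⟩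
    ⊕∈ (cs , Fcs , u≋) (ds , Fds , v≋) =
      (λ i → cs i + ds i) , (λ i → F-+ (Fcs i) (Fds i)) , ≋.trans (⊕-cong u≋ v≋) (≋.sym (lc-+ cs ds b))

    •∈ : ∀ {a u} → F a → u ∈F⟨ b ⟩ → a • u ∈F⟨ b ⟩
    •∈ {a} Fa (cs , Fcs , u≋) =
      (λ i → a * cs i) , (λ i → F-* Fa (Fcs i)) , ≋.trans (•-congˡ u≋) (≋.sym (lc-* a cs b))

    lc∈ : ∀ {m} (cs : Fin m → Carrier) (w : Fin m → V K) →
              (∀ i → F (cs i)) → (∀ i → w i ∈F⟨ b ⟩) → lc K cs w ∈F⟨ b ⟩
    lc∈ {zero} _ _ _ _ = 𝟎∈
    lc∈ {suc m} cs w Fcs w∈ = ⊕∈ (•∈ (Fcs zero) (w∈ zero))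
      (lc∈ (λ i → cs (suc i)) (λ i → w (suc i)) (λ i → Fcs (suc i)) (λ i → w∈ (suc i)))

  span-suc : ∀ {n} {b : Fin (suc n) → V K} {v} → v ∈F⟨ (λ i → b (suc i)) ⟩ → v ∈F⟨ b ⟩
  span-suc {b = b} (cs , Fcs , v≋) =
    (λ { zero → 0# ; (suc j) → cs j }) , (λ { zero → F-0# ; (suc j) → Fcs j }) ,
    ≋.trans v≋ (≋.sym (≋.trans (⊕-cong (•-zeroˡ (b zero)) ≋.refl) (⊕-identityˡ _)))

  ∈-span : ∀ {n} (b : Fin n → V K) i → b i ∈F⟨ b ⟩
  ∈-span b zero =
    (λ { zero → 1# ; (suc _) → 0# }) , (λ { zero → F-1# ; (suc _) → F-0# }) ,
    ≋.sym (≋.trans (⊕-cong (•-identityˡ (b zero)) (lc-zeroˡ (λ i → b (suc i)) (λ _ → refl))) (⊕-identityʳ _))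
  ∈-span b (suc i) = span-suc {b = b} (∈-span (λ j → b (suc j)) i)

  span-⊆ : ∀ {n m} {b : Fin n → V K} {b' : Fin m → V K} →
           (∀ i → b i ∈F⟨ b' ⟩) → ∀ {v} → v ∈F⟨ b ⟩ → v ∈F⟨ b' ⟩
  span-⊆ {b = b} {b'} b⊆ (cs , Fcs , v≋) = Span.resp b' (≋.sym v≋) (Span.lc∈ b' cs b Fcs b⊆)

  line-resp : ∀ {x u v} → u ≋ v → u ∈K⟨ x ⟩ → v ∈K⟨ x ⟩
  line-resp u≋v (μ , u≋) = μ , ≋.trans (≋.sym u≋v) u≋

  line-𝟎 : ∀ {x} → 𝟎 ∈K⟨ x ⟩
  line-𝟎 {x} = 0# , ≋.sym (•-zeroˡ x)

  line-self : ∀ x → x ∈K⟨ x ⟩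
  line-self x = 1# , ≋.sym (•-identityˡ x)

  line-• : ∀ {x u} a → u ∈K⟨ x ⟩ → a • u ∈K⟨ x ⟩
  line-• {x} a (μ , u≋) = a * μ , ≋.trans (•-congˡ u≋) (•-assoc a μ x)

  line-⊕ : ∀ {x u v} → u ∈K⟨ x ⟩ → v ∈K⟨ x ⟩ → u ⊕ v ∈K⟨ x ⟩
  line-⊕ {x} (μ , u≋) (ν , v≋) = μ + ν , ≋.trans (⊕-cong u≋ v≋) (≋.sym (•-distribʳ μ ν x))

  line-lc : ∀ {n} {x} (cs : Fin n → Carrier) (w : Fin n → V K) → (∀ i → w i ∈K⟨ x ⟩) → lc K cs w ∈K⟨ x ⟩
  line-lc {zero} _ _ _ = line-𝟎
  line-lc {suc n} cs w w∈ =
    line-⊕ (line-• (cs zero) (w∈ zero)) (line-lc (λ i → cs (suc i)) (λ i → w (suc i)) (λ i → w∈ (suc i)))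

  span-tail : ∀ {n} {b : Fin (suc n) → V K} {v} (v∈ : v ∈F⟨ b ⟩) →
              proj₁ v∈ zero ≈ 0# → v ∈F⟨ (λ i → b (suc i)) ⟩
  span-tail {b = b} (cs , Fcs , v≋) c₀≈0 = (λ i → cs (suc i)) , (λ i → Fcs (suc i)) ,
    ≋.trans v≋ (≋.trans (⊕-cong (≋.trans (•-congʳ c₀≈0) (•-zeroˡ (b zero))) ≋.refl) (⊕-identityˡ _))

  record Dependence {m} (w : Fin m → V K) : Set (c ⊔ ℓ) where
    constructor dependence
    field
      coeff : Fin m → Carrier
      coeff∈F : ∀ j → F (coeff j)
      relation : lc K coeff w ≋ 𝟎
      pivot : Fin m
      pivot≉0 : coeff pivot ≉ 0#

  Dependence-suc : ∀ {m} {w : Fin (suc m) → V K} → Dependence (λ j → w (suc j)) → Dependence w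
  Dependence-suc {w = w} (dependence cs Fcs rel j cⱼ≉0) =
    dependence (λ { zero → 0# ; (suc j) → cs j }) (λ { zero → F-0# ; (suc j) → Fcs j })
               (≋.trans (⊕-cong (•-zeroˡ (w zero)) rel) (⊕-identityˡ 𝟎)) (suc j) cⱼ≉0

  Dependence-eliminate : ∀ {m} (w : Fin (suc m) → V K) j₀ (es : Fin m → Carrier) → (∀ j → F (es j)) →
                         Dependence (λ j → w (punchIn j₀ j) ⊕ es j • w j₀) → Dependence w
  Dependence-eliminate w j₀ es Fes (dependence cs Fcs rel j cⱼ≉0) =
    dependence (insertAt cs j₀ e) (insertAt-all F cs j₀ Fcs (F-sum _ (λ j → F-* (Fcs j) (Fes j))))
               relation (punchIn j₀ j) (≡.subst (_≉ 0#) (≡.sym (insertAt-punchIn cs j₀ e j)) cⱼ≉0)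
    where
    e : Carrier
    e = sum (λ j → cs j * es j)
    relation : lc K (insertAt cs j₀ e) w ≋ 𝟎
    relation = begin
      lc K (insertAt cs j₀ e) w                                  ≈⟨ lc-insertAt cs j₀ e w ⟩
      e • w j₀ ⊕ lc K cs (λ j → w (punchIn j₀ j))                ≈⟨ ⊕-comm _ _ ⟩
      lc K cs (λ j → w (punchIn j₀ j)) ⊕ e • w j₀                ≈⟨ ⊕-cong ≋.refl (≋.sym (lc-multiples cs es (w j₀))) ⟩
      lc K cs (λ j → w (punchIn j₀ j)) ⊕ lc K cs (λ j → es j • w j₀) ≈⟨ ≋.sym (lc-⊕ cs _ _) ⟩
      lc K cs (λ j → w (punchIn j₀ j) ⊕ es j • w j₀)             ≈⟨ rel ⟩
      𝟎                                                          ∎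
      where open ≋-Reasoning

  steinitz : ∀ n (b : Fin n → V K) (w : Fin (suc n) → V K) → (∀ j → w j ∈F⟨ b ⟩) → Dependence w
  steinitz zero b w w∈ =
    dependence (λ _ → 1#) (λ _ → F-1#) (lc-zeroʳ (λ _ → 1#) {b = w} (λ j → proj₂ (proj₂ (w∈ j)))) zero 1≉0
  steinitz (suc n) b w w∈ with any? (λ j → ¬? (A j zero ≟ 0#))
    where
    A : Fin (suc (suc n)) → Fin (suc n) → Carrier
    A j = proj₁ (w∈ j)
  ... | no no-pivot = Dependence-suc (steinitz n (λ i → b (suc i)) (λ j → w (suc j))
        (λ j → span-tail {b = b} (w∈ (suc j)) (decidable-stable (_ ≟ 0#) (λ c≉0 → no-pivot (suc j , c≉0)))))
  ... | yes (j₀ , a≉0) = Dependence-eliminate w j₀ es Fes (steinitz n (λ i → b (suc i)) _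
        (λ j → span-tail {b = b} (Span.⊕∈ b (w∈ (punchIn j₀ j)) (Span.•∈ b (Fes j) (w∈ j₀))) (eliminated j)))
    where
    a : Carrier
    a = proj₁ (w∈ j₀) zero
    es : Fin (suc n) → Carrier
    es j = - (proj₁ (w∈ (punchIn j₀ j)) zero * inverse a a≉0)
    Fes : ∀ j → F (es j)
    Fes j = F-neg (F-* (proj₁ (proj₂ (w∈ (punchIn j₀ j))) zero) (F-inverse a≉0 (proj₁ (proj₂ (w∈ j₀)) zero)))
    eliminated : ∀ j → proj₁ (w∈ (punchIn j₀ j)) zero + es j * a ≈ 0#
    eliminated j = begin
      x + - (x * inverse a a≉0) * a      ≈⟨ +-congˡ (sym (-‿distribˡ-* _ a)) ⟩
      x + - ((x * inverse a a≉0) * a)    ≈⟨ +-congˡ (-‿cong (*-assoc x _ a)) ⟩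
      x + - (x * (inverse a a≉0 * a))    ≈⟨ +-congˡ (-‿cong (*-congˡ (*-inverseˡ a a≉0))) ⟩
      x + - (x * 1#)                     ≈⟨ +-congˡ (-‿cong (*-identityʳ x)) ⟩
      x + - x                            ≈⟨ -‿inverseʳ x ⟩
      0#                                 ∎
      where
      open ≈-Reasoning
      x : Carrier
      x = proj₁ (w∈ (punchIn j₀ j)) zero

  +-difference : ∀ {u x u' y} → u + x ≈ u' + y → x + - y ≈ u' + - u
  +-difference {u} {x} {u'} {y} e = begin
    x + - y                   ≈⟨ sym (+-identityˡ _) ⟩
    0# + (x + - y)            ≈⟨ +-congʳ (sym (-‿inverseʳ u)) ⟩
    (u + - u) + (x + - y)     ≈⟨ +-interchange _ _ _ _ ⟩
    (u + x) + (- u + - y)     ≈⟨ +-congʳ e ⟩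
    (u' + y) + (- u + - y)    ≈⟨ +-interchange _ _ _ _ ⟩
    (u' + - u) + (y + - y)    ≈⟨ +-congˡ (-‿inverseʳ y) ⟩
    (u' + - u) + 0#           ≈⟨ +-identityʳ _ ⟩
    u' + - u                  ∎
    where open ≈-Reasoning

  solve-linear : ∀ {a κ x y} → κ * a ≈ 1# → a * x + y ≈ 0# → x ≈ (- κ) * y
  solve-linear {a} {κ} {x} {y} κa≈1 ax+y≈0 = begin
    x            ≈⟨ ≈-*-unscale κa≈1 refl ⟩
    κ * (a * x)  ≈⟨ *-congˡ (+-inverseˡ-unique _ _ ax+y≈0) ⟩
    κ * - y      ≈⟨ sym (-‿distribʳ-* κ y) ⟩
    - (κ * y)    ≈⟨ -‿distribˡ-* κ y ⟩
    (- κ) * y    ∎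
    where open ≈-Reasoning

  ⊕-difference : ∀ {u a r u' b} → u ⊕ a • r ≋ u' ⊕ b • r → (a + - b) • r ≋ u' ⊕ (- 1#) • u
  ⊕-difference {u} {a} {r} {u'} {b} (e₁ , e₂) = component e₁ , component e₂
    where
    component : ∀ {uᵢ rᵢ u'ᵢ} → uᵢ + a * rᵢ ≈ u'ᵢ + b * rᵢ → (a + - b) * rᵢ ≈ u'ᵢ + (- 1#) * uᵢ
    component {uᵢ} {rᵢ} {u'ᵢ} e = begin
      (a + - b) * rᵢ        ≈⟨ distribʳ _ _ _ ⟩
      a * rᵢ + (- b) * rᵢ   ≈⟨ +-congˡ (sym (-‿distribˡ-* b rᵢ)) ⟩
      a * rᵢ + - (b * rᵢ)   ≈⟨ +-difference e ⟩
      u'ᵢ + - uᵢ            ≈⟨ +-congˡ (sym (-1*x≈-x uᵢ)) ⟩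
      u'ᵢ + (- 1#) * uᵢ     ∎
      where open ≈-Reasoning

  ⊕-solve-linear : ∀ {a κ v y} → κ * a ≈ 1# → a • v ⊕ y ≋ 𝟎 → v ≋ (- κ) • y
  ⊕-solve-linear κa≈1 (e₁ , e₂) = solve-linear κa≈1 e₁ , solve-linear κa≈1 e₂

  ⊕-drop-zero-term : ∀ {a v y} → a ≈ 0# → a • v ⊕ y ≋ 𝟎 → y ≋ 𝟎
  ⊕-drop-zero-term {a} {v} {y} a≈0 e =
    ≋.trans (≋.sym (⊕-identityˡ y)) (≋.trans (⊕-cong (≋.sym (≋.trans (•-congʳ a≈0) (•-zeroˡ v))) ≋.refl) e)

  module _ {p r : V K} (r∉Kp : ¬ r ∈K⟨ p ⟩) where

    ∉K⇒≉𝟎 : NonZeroV K r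
    ∉K⇒≉𝟎 r≈0 = r∉Kp (line-resp (≋.sym r≈0) line-𝟎)

    off-line-coefficient≈0 : ∀ {a} → a • r ∈K⟨ p ⟩ → a ≈ 0#
    off-line-coefficient≈0 {a} ar∈Kp with a ≟ 0#
    ... | yes a≈0 = a≈0
    ... | no a≉0 = ⊥-elim (r∉Kp (line-resp (≋.sym (•-unscale (*-inverseˡ a a≉0) ≋.refl)) (line-• _ ar∈Kp)))

    off-line-coefficient-unique : ∀ {u u' a b} → u ∈K⟨ p ⟩ → u' ∈K⟨ p ⟩ →
                                  u ⊕ a • r ≋ u' ⊕ b • r → a ≈ b
    off-line-coefficient-unique {u} {u'} {a} {b} u∈Kp u'∈Kp e = x∙y⁻¹≈ε⇒x≈y a b
      (off-line-coefficient≈0 (line-resp (≋.sym (⊕-difference e)) (line-⊕ u'∈Kp (line-• (- 1#) u∈Kp))))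

  -- v, r and a basis of π ∩ 𝓕(P) are k + 2 vectors in the (k + 1)-dimensional π.
  head-decomposition : ∀ {k p r} (b : Fin (suc k) → V K) → IsFDim K F (Meet K F p b) k →
                       r ∈F⟨ b ⟩ → ¬ r ∈K⟨ p ⟩ →
                       ∀ {v} → v ∈F⟨ b ⟩ → ∃ λ u → u ∈K⟨ p ⟩ × ∃ λ c → F c × v ≋ u ⊕ c • r
  head-decomposition {k} {p} {r} b (h , h∈Meet , h-indep , _) r∈π r∉Kp {v} v∈π
    with steinitz (suc k) b (λ { zero → v ; (suc zero) → r ; (suc (suc i)) → h i })
                            (λ { zero → v∈π ; (suc zero) → r∈π ; (suc (suc i)) → proj₂ (h∈Meet i) })
  ... | dependence cs Fcs relation j cⱼ≉0 = decompose (cs zero ≟ 0#) (cs (suc zero) ≟ 0#)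
    where
    cs' : Fin k → Carrier
    cs' i = cs (suc (suc i))
    m∈Kp : lc K cs' h ∈K⟨ p ⟩
    m∈Kp = line-lc cs' h (λ i → proj₁ (h∈Meet i))
    decompose : Dec (cs zero ≈ 0#) → Dec (cs (suc zero) ≈ 0#) →
                ∃ λ u → u ∈K⟨ p ⟩ × ∃ λ c → F c × v ≋ u ⊕ c • r
    decompose (no c₀≉0) _ =
      κ • lc K cs' h , line-• κ m∈Kp , κ * cs (suc zero) , F-* (F-neg (F-inverse c₀≉0 (Fcs zero))) (Fcs (suc zero)) ,
      (begin
        v                                           ≈⟨ ⊕-solve-linear (*-inverseˡ _ c₀≉0) relation ⟩
        κ • (cs (suc zero) • r ⊕ lc K cs' h)        ≈⟨ •-distribˡ κ _ _ ⟩
        κ • cs (suc zero) • r ⊕ κ • lc K cs' h      ≈⟨ ⊕-comm _ _ ⟩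
        κ • lc K cs' h ⊕ κ • cs (suc zero) • r      ≈⟨ ⊕-cong ≋.refl (•-assoc κ _ r) ⟩
        κ • lc K cs' h ⊕ (κ * cs (suc zero)) • r    ∎)
      where
      open ≋-Reasoning
      κ : Carrier
      κ = - inverse (cs zero) c₀≉0
    decompose (yes c₀≈0) (no c₁≉0) = ⊥-elim (r∉Kp (line-resp
      (≋.sym (⊕-solve-linear (*-inverseˡ _ c₁≉0) (⊕-drop-zero-term c₀≈0 relation))) (line-• _ m∈Kp)))
    decompose (yes c₀≈0) (yes c₁≈0) = ⊥-elim (cⱼ≉0 (all≈0 j))
      where
      all≈0 : ∀ j → cs j ≈ 0#
      all≈0 zero = c₀≈0
      all≈0 (suc zero) = c₁≈0
      all≈0 (suc (suc i)) =
        h-indep cs' (λ i → Fcs (suc (suc i))) (⊕-drop-zero-term c₁≈0 (⊕-drop-zero-term c₀≈0 relation)) i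

  shifted-point∈span : ∀ {k} {p r u : V K} (b : Fin (suc k) → V K) → IsFDim K F (Meet K F p b) k →
                       r ∈F⟨ b ⟩ → ¬ r ∈K⟨ p ⟩ → u ∈K⟨ p ⟩ → InL K F b (u ⊕ r) → u ⊕ r ∈F⟨ b ⟩
  shifted-point∈span {u = u} b head-dim r∈π r∉Kp u∈Kp (v , v≉0 , (μ , v≋μx) , v∈π)
    with head-decomposition b head-dim r∈π r∉Kp v∈π
  ... | u' , u'∈Kp , c , Fc , v≋u'+cr =
    Span.resp b (≋.sym (•-unscale (*-inverseˡ μ μ≉0) (≋.sym v≋μx))) (Span.•∈ b (F-inverse μ≉0 Fμ) v∈π)
    where
    μ≉0 : μ ≉ 0#
    μ≉0 = scalar-≉0 v≋μx v≉0
    μ≈c : μ ≈ c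
    μ≈c = off-line-coefficient-unique r∉Kp (line-• μ u∈Kp) u'∈Kp
            (≋.trans (≋.sym (•-distribˡ μ u _)) (≋.trans (≋.sym v≋μx) v≋u'+cr))
    Fμ : F μ
    Fμ = F-resp (sym μ≈c) Fc

  club-span-⊆ : ∀ {k} {p r : V K} (b b' : Fin (suc k) → V K) →
                IsFDim K F (Meet K F p b) k → IsFDim K F (Meet K F p b') k →
                (∀ x → NonZeroV K x → InL K F b x → InL K F b' x) →
                r ∈F⟨ b ⟩ → r ∈F⟨ b' ⟩ → ¬ r ∈K⟨ p ⟩ → ∀ {v} → v ∈F⟨ b ⟩ → v ∈F⟨ b' ⟩
  club-span-⊆ {p = p} {r} b b' head-dim head-dim' L⊆L' r∈π r∈π' r∉Kp v∈π
    with head-decomposition b head-dim r∈π r∉Kp v∈π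
  ... | u , u∈Kp , c , Fc , v≋u+cr =
    π'.resp (≋.sym v≋u+cr) (π'.⊕∈ u∈π' (π'.•∈ Fc r∈π'))
    where
    module π = Span b
    module π' = Span b'
    u∈π : u ∈F⟨ b ⟩
    u∈π = π.resp (≋.trans (⊕-cong v≋u+cr ≋.refl) (⊕-•-cancelʳ u c r)) (π.⊕∈ v∈π (π.•∈ (F-neg Fc) r∈π))
    x : V K
    x = u ⊕ r
    x∉Kp : ¬ x ∈K⟨ p ⟩
    x∉Kp x∈Kp = r∉Kp (line-resp (⊕-•-cancelʳ r 1# u)
                  (line-⊕ (line-resp (⊕-cong ≋.refl (≋.sym (•-identityˡ u))) (line-resp (⊕-comm u r) x∈Kp))
                          (line-• (- 1#) u∈Kp)))
    x≉𝟎 : NonZeroV K x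
    x≉𝟎 = ∉K⇒≉𝟎 x∉Kp
    x∈π' : x ∈F⟨ b' ⟩
    x∈π' = shifted-point∈span b' head-dim' r∈π' r∉Kp u∈Kp
             (L⊆L' x x≉𝟎 (x , x≉𝟎 , line-self x , π.⊕∈ u∈π r∈π))
    u∈π' : u ∈F⟨ b' ⟩
    u∈π' = π'.resp (≋.trans (⊕-cong (⊕-cong ≋.refl (≋.sym (•-identityˡ r))) ≋.refl) (⊕-•-cancelʳ u 1# r))
                     (π'.⊕∈ x∈π' (π'.•∈ (F-neg F-1#) r∈π'))

  club-span-unique : ∀ {k} {p r : V K} (b b' : Fin (suc k) → V K) →
                     IsClub K F (suc k) b p → IsClub K F (suc k) b' p → SameL K F b b' →
                     r ∈F⟨ b ⟩ → r ∈F⟨ b' ⟩ → ¬ r ∈K⟨ p ⟩ → SameSpan K F b b'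
  club-span-unique b b' (head-dim , _) (head-dim' , _) L≡L' r∈π r∈π' r∉Kp =
    (λ _ → club-span-⊆ b b' head-dim head-dim' (λ x x≉0 → proj₁ (L≡L' x x≉0)) r∈π r∈π' r∉Kp) ,
    (λ _ → club-span-⊆ b' b head-dim' head-dim (λ x x≉0 → proj₂ (L≡L' x x≉0)) r∈π' r∈π r∉Kp)

  •-cancelʳ : ∀ {a b r} → NonZeroV K r → a • r ≋ b • r → a ≈ b
  •-cancelʳ {a} {b} r≉0 ar≋br = x∙y⁻¹≈ε⇒x≈y a b (•-zero-divisor r≉0
    (≋.trans (⊕-difference (⊕-cong ≋.refl ar≋br)) (≋.trans (⊕-identityˡ _) (•-zeroʳ _))))

  weight-one⇒scalar∈F : ∀ {k p r} (b : Fin k → V K) → IsClub K F k b p → r ∈F⟨ b ⟩ → ¬ r ∈K⟨ p ⟩ →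
                        ∀ {a} → a • r ∈F⟨ b ⟩ → F a
  weight-one⇒scalar∈F {r = r} b (_ , weight-one) r∈π r∉Kp {a} ar∈π
    with weight-one r (∉K⇒≉𝟎 r∉Kp) r∉Kp (r , ∉K⇒≉𝟎 r∉Kp , line-self r , r∈π)
  ... | w , _ , _ , w-spans with w-spans r (line-self r , r∈π) | w-spans (a • r) ((a , ≋.refl) , ar∈π)
  ...   | cs , Fcs , r≋ | ds , Fds , ar≋ = F-resp (sym a≈) (F-* (Fds zero) (F-inverse c≉0 (Fcs zero)))
    where
    r≋cw : r ≋ cs zero • w zero
    r≋cw = ≋.trans r≋ (⊕-identityʳ _)
    c≉0 : cs zero ≉ 0#
    c≉0 = scalar-≉0 r≋cw (∉K⇒≉𝟎 r∉Kp)
    a≈ : a ≈ ds zero * inverse (cs zero) c≉0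
    a≈ = •-cancelʳ (∉K⇒≉𝟎 r∉Kp) (begin
      a • r                                             ≈⟨ ≋.trans ar≋ (⊕-identityʳ _) ⟩
      ds zero • w zero                                  ≈⟨ •-congˡ (•-unscale (*-inverseˡ _ c≉0) (≋.sym r≋cw)) ⟩
      ds zero • inverse (cs zero) c≉0 • r               ≈⟨ •-assoc _ _ r ⟩
      (ds zero * inverse (cs zero) c≉0) • r             ∎)
      where open ≋-Reasoning

  generator-off-head : ∀ {k p} (b : Fin (suc k) → V K) → FIndep K F b → IsFDim K F (Meet K F p b) k →
                       (∀ v → Dec (v ∈K⟨ p ⟩)) → ∃ λ i → ¬ b i ∈K⟨ p ⟩
  generator-off-head {k} b b-indep (h , _ , _ , h-spans) _∈K? with all? (λ i → b i ∈K? )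
  ... | no ¬all = ¬∀⟶∃¬ (suc k) _ (λ i → b i ∈K?) ¬all
  ... | yes all∈Kp with steinitz k h b (λ i → h-spans (b i) (all∈Kp i , ∈-span b i))
  ...   | dependence cs Fcs relation j cⱼ≉0 = ⊥-elim (cⱼ≉0 (b-indep cs Fcs relation j))

  line-dec : ∀ {n} → Enumeration setoid (λ _ → ⊤) n → ∀ p v → Dec (v ∈K⟨ p ⟩)
  line-dec E p v =
    map′ (λ (i , e) → element i , e) (λ (μ , e) → index tt , ≋.trans e (•-congʳ (sym (element-index tt))))
         (any? (λ i → (proj₁ v ≟ proj₁ (element i • p)) ×-dec (proj₂ v ≟ proj₂ (element i • p))))
    where open Enumeration E

  SameL-trans : ∀ {n m o} {b : Fin n → V K} {b' : Fin m → V K} {b'' : Fin o → V K} →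
                SameL K F b b' → SameL K F b' b'' → SameL K F b b''
  SameL-trans L≡L' L'≡L'' x x≉0 =
    (λ x∈L → proj₁ (L'≡L'' x x≉0) (proj₁ (L≡L' x x≉0) x∈L)) ,
    (λ x∈L'' → proj₂ (L≡L' x x≉0) (proj₂ (L'≡L'' x x≉0) x∈L''))

  SameSpan-setoid : ℕ → Setoid c (c ⊔ ℓ)
  SameSpan-setoid k = record
    { Carrier = Fin k → V K
    ; _≈_ = SameSpan K F
    ; isEquivalence = record
      { refl = (λ _ v∈ → v∈) , (λ _ v∈ → v∈)
      ; sym = λ (⊆ , ⊇) → ⊇ , ⊆
      ; trans = λ (⊆₁ , ⊇₁) (⊆₂ , ⊇₂) → (λ v v∈ → ⊆₂ v (⊆₁ v v∈)) , (λ v v∈ → ⊇₁ v (⊇₂ v v∈))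
      }
    }

  SameSpan-pointwise : ∀ {k} (b b' : Fin k → V K) → (∀ i → b i ≋ b' i) → SameSpan K F b b'
  SameSpan-pointwise b b' b≋b' =
    (λ _ → span-⊆ (λ i → Span.resp b' (≋.sym (b≋b' i)) (∈-span b' i))) ,
    (λ _ → span-⊆ (λ i → Span.resp b (b≋b' i) (∈-span b i)))

  module Scaled (μ ν : Carrier) (νμ≈1 : ν * μ ≈ 1#) where

    scaled : ∀ {n} → (Fin n → V K) → Fin n → V K
    scaled b i = μ • b i

    μν≈1 : μ * ν ≈ 1#
    μν≈1 = trans (*-comm μ ν) νμ≈1

    ∈-scaled : ∀ {n} {b : Fin n → V K} {v} → v ∈F⟨ b ⟩ → μ • v ∈F⟨ scaled b ⟩
    ∈-scaled {b = b} (cs , Fcs , v≋) = cs , Fcs , ≋.trans (•-congˡ v≋) (≋.sym (lc-• μ cs b))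

    ∈-unscaled : ∀ {n} {b : Fin n → V K} {v} → v ∈F⟨ scaled b ⟩ → ν • v ∈F⟨ b ⟩
    ∈-unscaled {b = b} (cs , Fcs , v≋) =
      cs , Fcs , ≋.sym (•-unscale νμ≈1 (≋.sym (≋.trans v≋ (lc-• μ cs b))))

    scaled-independent : ∀ {n} {b : Fin n → V K} → FIndep K F b → FIndep K F (scaled b)
    scaled-independent {b = b} b-indep cs Fcs relation = b-indep cs Fcs
      (≋.trans (•-unscale νμ≈1 (≋.trans (≋.sym (lc-• μ cs b)) relation)) (•-zeroʳ ν))

    InL-scaled : ∀ {n} {b : Fin n → V K} {x} → InL K F b x → InL K F (scaled b) x
    InL-scaled (v , v≉0 , (α , v≋) , v∈π) =
      μ • v , •-≉𝟎 νμ≈1 v≉0 , (μ * α , ≋.trans (•-congˡ v≋) (•-assoc _ _ _)) , ∈-scaled v∈π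

    InL-unscaled : ∀ {n} {b : Fin n → V K} {x} → InL K F (scaled b) x → InL K F b x
    InL-unscaled (v , v≉0 , (α , v≋) , v∈π) =
      ν • v , •-≉𝟎 μν≈1 v≉0 , (ν * α , ≋.trans (•-congˡ v≋) (•-assoc _ _ _)) , ∈-unscaled v∈π

    scaled-SameL : ∀ {n} (b : Fin n → V K) → SameL K F b (scaled b)
    scaled-SameL b x x≉0 = InL-scaled , InL-unscaled

    scaled-dim : ∀ {n d} {b : Fin n → V K} {x} → IsFDim K F (Meet K F x b) d → IsFDim K F (Meet K F x (scaled b)) d
    scaled-dim (w , w∈Meet , w-indep , w-spans) =
      scaled w , (λ i → line-• μ (proj₁ (w∈Meet i)) , ∈-scaled (proj₂ (w∈Meet i))) , scaled-independent w-indep ,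
      λ v (v∈Kx , v∈π) → Span.resp (scaled w) (≋.sym (•-unscale μν≈1 ≋.refl))
                           (∈-scaled (w-spans (ν • v) (line-• ν v∈Kx , ∈-unscaled v∈π)))

    scaled-club : ∀ {k} {b : Fin k → V K} {p} → IsClub K F k b p → IsClub K F k (scaled b) p
    scaled-club (head-dim , weight-one) =
      scaled-dim head-dim , λ x x≉0 x∉Kp x∈L → scaled-dim (weight-one x x≉0 x∉Kp (InL-unscaled x∈L))

    scaled-SameSpan : ∀ {k} {b b' : Fin k → V K} → SameSpan K F b b' → SameSpan K F (scaled b) (scaled b')
    scaled-SameSpan {b = b} {b'} (⊆ , ⊇) =
      (λ v v∈ → Span.resp (scaled b') (≋.sym (•-unscale μν≈1 ≋.refl)) (∈-scaled (⊆ _ (∈-unscaled v∈)))) ,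
      (λ v v∈ → Span.resp (scaled b) (≋.sym (•-unscale μν≈1 ≋.refl)) (∈-scaled (⊇ _ (∈-unscaled v∈))))

  F-scaled-SameSpan : ∀ {k} {f} (b : Fin k → V K) → F f → (f≉0 : f ≉ 0#) → SameSpan K F b (λ i → f • b i)
  F-scaled-SameSpan {f = f} b Ff f≉0 =
    (λ _ → span-⊆ (λ i → Span.resp fb (≋.sym (•-unscale (*-inverseˡ f f≉0) ≋.refl))
                                      (Span.•∈ fb (F-inverse f≉0 Ff) (∈-span fb i)))) ,
    (λ _ → span-⊆ (λ i → Span.•∈ b Ff (∈-span b i)))
    where
    fb : Fin _ → V K
    fb i = f • b i

  record Transversal (N : ℕ) : Set (c ⊔ ℓ) where
    field
      rep : Fin N → Carrier
      rep≉0 : ∀ i → rep i ≉ 0#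
      rep-injective : ∀ {i j f} → F f → rep i ≈ f * rep j → i ≡ j
      rep-surjective : ∀ {μ} → μ ≉ 0# → ∃ λ i → ∃ λ f → F f × μ ≈ f * rep i

  module Classification {N k} {p r : V K} (T : Transversal N) (b : Fin (suc k) → V K)
                        (club : IsClub K F (suc k) b p) (r∈π : r ∈F⟨ b ⟩) (r∉Kp : ¬ r ∈K⟨ p ⟩) where
    open Transversal T

    module Rep (i : Fin N) = Scaled (rep i) (inverse (rep i) (rep≉0 i)) (*-inverseˡ _ (rep≉0 i))

    rep-club : Fin N → Fin (suc k) → V K
    rep-club i = Rep.scaled i b

    rep-club-injective : ∀ i j → SameSpan K F (rep-club i) (rep-club j) → i ≡ j
    rep-club-injective i j (⊆ , _) = rep-injective
      (weight-one⇒scalar∈F b club r∈π r∉Kp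
        (Span.resp b (•-assoc _ _ r) (Rep.∈-unscaled j {b = b} (⊆ _ (Rep.∈-scaled i {b = b} r∈π)))))
      (begin
        rep i                     ≈⟨ ≈-*-unscale (*-inverseˡ _ (rep≉0 j)) (*-comm _ _) ⟩
        repⱼ⁻¹ * (rep i * rep j)  ≈⟨ sym (*-assoc _ _ _) ⟩
        (repⱼ⁻¹ * rep i) * rep j  ∎)
      where
      open ≈-Reasoning
      repⱼ⁻¹ : Carrier
      repⱼ⁻¹ = inverse (rep j) (rep≉0 j)

    rep-club-surjective : ∀ b' → SameL K F b b' → IsClub K F (suc k) b' p → ∃ λ i → SameSpan K F b' (rep-club i)
    rep-club-surjective b' L≡L' club'
      with proj₁ (L≡L' r (∉K⇒≉𝟎 r∉Kp)) (r , ∉K⇒≉𝟎 r∉Kp , line-self r , r∈π)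
    ... | v , v≉0 , (μ , v≋μr) , v∈π' with rep-surjective (scalar-≉0 v≋μr v≉0)
    ...   | i , f , Ff , μ≈f·repᵢ = i , (begin
      b'                          ≈⟨ SameSpan-pointwise b' (Up.scaled μ⁻¹π')
                                         (λ j → •-unscale (*-inverseʳ μ μ≉0) ≋.refl) ⟩
      Up.scaled μ⁻¹π'             ≈⟨ Up.scaled-SameSpan {b = b} {μ⁻¹π'} π≈μ⁻¹π' ⟨
      Up.scaled b                 ≈⟨ SameSpan-pointwise (Up.scaled b) (λ j → f • rep-club i j)
                                         (λ j → ≋.trans (•-congʳ μ≈f·repᵢ) (≋.sym (•-assoc f (rep i) (b j)))) ⟩
      (λ j → f • rep-club i j)    ≈⟨ F-scaled-SameSpan (rep-club i) Ff f≉0 ⟨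
      rep-club i                  ∎)
      where
      open SetoidReasoning (SameSpan-setoid (suc k))
      μ≉0 : μ ≉ 0#
      μ≉0 = scalar-≉0 v≋μr v≉0
      f≉0 : f ≉ 0#
      f≉0 f≈0 = μ≉0 (trans μ≈f·repᵢ (trans (*-congʳ f≈0) (zeroˡ _)))
      module Up = Scaled μ (inverse μ μ≉0) (*-inverseˡ μ μ≉0)
      module Down = Scaled (inverse μ μ≉0) μ (*-inverseʳ μ μ≉0)
      μ⁻¹π' : Fin (suc k) → V K
      μ⁻¹π' = Down.scaled b'
      r∈μ⁻¹π' : r ∈F⟨ μ⁻¹π' ⟩
      r∈μ⁻¹π' = Span.resp μ⁻¹π' (≋.sym (•-unscale (*-inverseˡ μ μ≉0) (≋.sym v≋μr))) (Down.∈-scaled {b = b'} v∈π')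
      π≈μ⁻¹π' : SameSpan K F b μ⁻¹π'
      π≈μ⁻¹π' = club-span-unique b μ⁻¹π' club (Down.scaled-club {b = b'} club')
                  (SameL-trans {b = b} {b'} {Down.scaled b'} L≡L' (Down.scaled-SameL b')) r∈π r∈μ⁻¹π' r∉Kp

  clubs-with-head : ∀ {N k p} → Transversal N → (∀ v → Dec (v ∈K⟨ p ⟩)) →
    (b : Fin (suc k) → V K) → FIndep K F b → IsClub K F (suc k) b p →
    Σ (Fin N → (Fin (suc k) → V K)) λ e →
      (∀ i → FIndep K F (e i) × SameL K F b (e i) × IsClub K F (suc k) (e i) p)
      × (∀ i j → SameSpan K F (e i) (e j) → i ≡ j)
      × ((b' : Fin (suc k) → V K) → FIndep K F b' → SameL K F b b' → IsClub K F (suc k) b' p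
         → ∃ λ i → SameSpan K F b' (e i))
  clubs-with-head T _∈K? b b-indep club with generator-off-head b b-indep (proj₁ club) _∈K?
  ... | i₀ , bᵢ₀∉Kp =
    rep-club ,
    (λ i → Rep.scaled-independent i {b = b} b-indep , Rep.scaled-SameL i b , Rep.scaled-club i {b = b} club) ,
    rep-club-injective ,
    (λ b' _ → rep-club-surjective b')
    where open Classification T b club (∈-span b i₀) bᵢ₀∉Kp

  module Counting {Q q₀} (K* : Enumeration setoid (λ x → ⊤ × x ≉ 0#) Q)
                         (F* : Enumeration setoid (λ x → F x × x ≉ 0#) q₀) where
    private
      module K* = Enumeration K*
      module F* = Enumeration F*

    -- (i , s) ↦ F*[s] · rep i is a bijection Fin N × F* → K*.
    module Size {N} (T : Transversal N) where
      open Transversal T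

      encode : Fin N × Fin q₀ → Fin Q
      encode (i , s) = K*.index (tt , *-≉0 (proj₂ (F*.element∈P s)) (rep≉0 i))

      encode-injective : ∀ {x y} → encode x ≡ encode y → x ≡ y
      encode-injective {i , s} {j , t} e
        with rep-injective F[s⁻¹t] (trans (≈-*-unscale (*-inverseˡ _ fₛ≉0) (sym sᵢ≈tⱼ)) (sym (*-assoc _ _ _)))
        where
        fₛ≉0 : F*.element s ≉ 0#
        fₛ≉0 = proj₂ (F*.element∈P s)
        sᵢ≈tⱼ : F*.element s * rep i ≈ F*.element t * rep j
        sᵢ≈tⱼ = K*.index-injective _ _ e
        F[s⁻¹t] : F (inverse _ fₛ≉0 * F*.element t)
        F[s⁻¹t] = F-* (F-inverse fₛ≉0 (proj₁ (F*.element∈P s))) (proj₁ (F*.element∈P t))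
      ... | ≡.refl = ≡.cong (i ,_) (F*.element-injective (*-cancelʳ-≉0 (rep≉0 i) (K*.index-injective _ _ e)))

      decomposition : ∀ m → Σ (Fin N × Fin q₀) λ (i , s) → K*.element m ≈ F*.element s * rep i
      decomposition m with rep-surjective (proj₂ (K*.element∈P m))
      ... | i , f , Ff , m≈f·repᵢ = (i , F*.index (Ff , f≉0)) , trans m≈f·repᵢ (*-congʳ (sym (F*.element-index _)))
        where
        f≉0 : f ≉ 0#
        f≉0 f≈0 = proj₂ (K*.element∈P m) (trans m≈f·repᵢ (trans (*-congʳ f≈0) (zeroˡ _)))

      decode : Fin Q → Fin N × Fin q₀
      decode m = proj₁ (decomposition m)

      decode-injective : ∀ {m m'} → decode m ≡ decode m' → m ≡ m'
      decode-injective {m} {m'} e = K*.element-injective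
        (trans (proj₂ (decomposition m))
        (trans (reflexive (≡.cong (λ (i , s) → F*.element s * rep i) e)) (sym (proj₂ (decomposition m')))))

    transversal-size : ∀ {N} → Transversal N → N ℕ.* q₀ ≡ Q
    transversal-size {N} T = cantor-schröder-bernstein
      {f = λ x → encode (remQuot q₀ x)} {g = λ m → uncurry combine (decode m)}
      (λ e → remQuot-injective N (encode-injective e))
      (λ e → decode-injective (combine-injective′ e))
      where open Size T

    infix 4 _∼_
    _∼_ : Fin Q → Fin Q → Set ℓ
    j ∼ m = ∃ λ s → K*.element j ≈ F*.element s * K*.element m

    ∼-dec : ∀ j m → Dec (j ∼ m)
    ∼-dec j m = any? (λ s → K*.element j ≟ (F*.element s * K*.element m))

    F-multiple⇒∼ : ∀ {j m f} → F f → K*.element j ≈ f * K*.element m → j ∼ m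
    F-multiple⇒∼ {j} {m} {f} Ff j≈f·m = F*.index (Ff , f≉0) , trans j≈f·m (*-congʳ (sym (F*.element-index _)))
      where
      f≉0 : f ≉ 0#
      f≉0 f≈0 = proj₂ (K*.element∈P j) (trans j≈f·m (trans (*-congʳ f≈0) (zeroˡ _)))

    ∼-refl : ∀ {m} → m ∼ m
    ∼-refl = F-multiple⇒∼ F-1# (sym (*-identityˡ _))

    ∼-sym : ∀ {j m} → j ∼ m → m ∼ j
    ∼-sym (s , j≈s·m) =
      F-multiple⇒∼ (F-inverse fₛ≉0 (proj₁ (F*.element∈P s))) (≈-*-unscale (*-inverseˡ _ fₛ≉0) j≈s·m)
      where
      fₛ≉0 : F*.element s ≉ 0#
      fₛ≉0 = proj₂ (F*.element∈P s)

    ∼-trans : ∀ {j m o} → j ∼ m → m ∼ o → j ∼ o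
    ∼-trans (s , j≈s·m) (t , m≈t·o) = F-multiple⇒∼ (F-* (proj₁ (F*.element∈P s)) (proj₁ (F*.element∈P t)))
      (trans j≈s·m (trans (*-congˡ m≈t·o) (sym (*-assoc _ _ _))))

    IsLeast : Fin Q → Set ℓ
    IsLeast m = ∀ j → j ∼ m → m Fin.≤ j

    transversal-exists : ∃ Transversal
    transversal-exists with enumerate Q {P = IsLeast} (λ m → all? (λ j → ∼-dec j m →-dec (m ≤? j)))
    ... | N , R = N , record
      { rep = λ i → K*.element (R.element i)
      ; rep≉0 = λ i → proj₂ (K*.element∈P (R.element i))
      ; rep-injective = λ {i} {j} Ff e → R.element-injective (≤-antisym
          (R.element∈P i _ (∼-sym (F-multiple⇒∼ Ff e))) (R.element∈P j _ (F-multiple⇒∼ Ff e)))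
      ; rep-surjective = surjective
      }
      where
      module R = Enumeration R
      surjective : ∀ {μ} → μ ≉ 0# → ∃ λ i → ∃ λ f → F f × μ ≈ f * K*.element (R.element i)
      surjective μ≉0 with least (λ j → ∼-dec j m) (∼-refl {m})
        where
        m : Fin Q
        m = K*.index (tt , μ≉0)
      ... | ρ , ρ∼m , ρ-least with ∼-sym ρ∼m
      ...   | s , m≈s·ρ = R.index ρ-isLeast , F*.element s , proj₁ (F*.element∈P s) ,
        trans (sym (K*.element-index _))
              (trans m≈s·ρ (*-congˡ (reflexive (≡.cong K*.element (≡.sym (R.element-index ρ-isLeast))))))
        where
        ρ-isLeast : IsLeast ρ
        ρ-isLeast j j∼ρ = ρ-least (∼-trans j∼ρ ρ∼m)

  transversal : ∀ {n q} → Enumeration setoid (λ _ → ⊤) n → Enumeration setoid F q → .{{_ : NonZero (q ∸ 1)}} →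
                Transversal ((n ∸ 1) / (q ∸ 1))
  transversal {zero} K-enum _ = ⊥-elim (Enumeration-empty setoid K-enum {x = 0#} tt)
  transversal {q = zero} _ F-enum = ⊥-elim (Enumeration-empty setoid F-enum F-0#)
  transversal {suc Q} {suc q₀} K-enum F-enum = ≡.subst Transversal N≡Q/q₀ T
    where
    open Counting (Enumeration-remove setoid K-enum tt) (Enumeration-remove setoid F-enum F-0#)
    N : ℕ
    N = proj₁ transversal-exists
    T : Transversal N
    T = proj₂ transversal-exists
    N≡Q/q₀ : N ≡ Q / q₀
    N≡Q/q₀ = ≡.trans (≡.sym (m*n/n≡m N q₀)) (≡.cong (_/ q₀) (transversal-size T))

lemma3p2 : ∀ {c ℓ} (K : CommutativeRing c ℓ) (F : CommutativeRing.Carrier K → Set ℓ)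
    (q t k : ℕ) → IsPrimePower q → 2 ≤ t → 2 ≤ k
    → IsField K → IsSubfield K F → SubHasSize K F q → HasSize K (q ^ t)
    → {{_ : NonZero (q ∸ 1)}}
    → (p : V K) → NonZeroV K p
    → ((b b' : Fin k → V K) → FIndep K F b → FIndep K F b'
        → SameL K F b b' → IsClub K F k b p → IsClub K F k b' p
        → (r : V K) → NonZeroV K r → InFSpan K F b r → InFSpan K F b' r
        → ¬ InKSpan K F p r
        → SameSpan K F b b')
      × ((b : Fin k → V K) → FIndep K F b → IsClub K F k b p
        → Σ (Fin ((q ^ t ∸ 1) / (q ∸ 1)) → (Fin k → V K)) λ e →
            (∀ i → FIndep K F (e i) × SameL K F b (e i) × IsClub K F k (e i) p)
            × (∀ i j → SameSpan K F (e i) (e j) → i ≡ j)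
            × ((b' : Fin k → V K) → FIndep K F b' → SameL K F b b' → IsClub K F k b' p
               → ∃ λ i → SameSpan K F b' (e i)))
lemma3p2 K F q t .(suc (suc _)) _ _ (s≤s (s≤s z≤n)) isField isSubfield HF HK p _ =
  (λ b b' _ _ L≡L' club club' r _ r∈π r∈π' r∉Kp → club-span-unique b b' club club' L≡L' r∈π r∈π' r∉Kp) ,
  clubs-with-head (transversal K-enum (SubHasSize⇒Enumeration K HF)) (line-dec K-enum p)
  where
  open FieldExtension K F isField isSubfield (HasSize⇒≈-dec K HK)
  K-enum : Enumeration (CommutativeRing.setoid K) (λ _ → ⊤) (q ^ t)
  K-enum = HasSize⇒Enumeration K HK
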